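{- Let $M=x^2+x+1\in\mathbb{F}_2[x]$, $r\ge2$, $u\ge1$, and $A=(M^{2^r-2}+\cdots+M+1)^{2^u}$. Then $\ell_A=2^u+1$.
   Context: For nonzero $A\in\mathbb{F}_2[x]$, the Collatz transformations are: $A_0=A$, and for $k\ge0$, $A_{2k+1}=A_{2k}/(x^{a_{2k}}(x+1)^{b_{2k}})$ where $a_{2k},b_{2k}$ are the multiplicities of $x$ and $x+1$ in $A_{2k}$, and $A_{2k+2}=1+MA_{2k+1}$. The length $\ell_A$ is $1+\min\{k\ge0: A_{2k+1}=1\}$, i.e. the number of terms of the sequence $A_1,A_3,A_5,\dots$ up to and including its first term equal to $1$. -}

module Defs where

open import Data.Bool using (Bool; true; false; _xor_; if_then_else_)
open import Data.List using (List; []; _∷_; length)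
open import Data.Nat using (ℕ; zero; suc; _<_)
open import Data.Product using (_×_)
open import Relation.Binary.PropositionalEquality using (_≡_; _≢_)

-- Polynomials over F₂: coefficient lists, lowest degree first.
-- Canonical form: no trailing 'false' (so the zero polynomial is []).
Poly : Set
Poly = List Bool

norm : Poly → Poly
norm [] = []
norm (b ∷ p) with norm p
... | [] = if b then true ∷ [] else []
... | q@(_ ∷ _) = b ∷ q

addRaw : Poly → Poly → Poly
addRaw [] q = q
addRaw p@(_ ∷ _) [] = p
addRaw (a ∷ p) (b ∷ q) = (a xor b) ∷ addRaw p q

_⊕_ : Poly → Poly → Poly
p ⊕ q = norm (addRaw p q)

_⊗_ : Poly → Poly → Poly
[] ⊗ q = []
(b ∷ p) ⊗ q = (if b then norm q else []) ⊕ norm (false ∷ (p ⊗ q))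

one : Poly
one = true ∷ []

M : Poly
M = true ∷ true ∷ true ∷ []

_^ᵖ_ : Poly → ℕ → Poly
p ^ᵖ zero = one
p ^ᵖ suc n = p ⊗ (p ^ᵖ n)

geomSum : Poly → ℕ → Poly
geomSum p zero = []
geomSum p (suc n) = geomSum p n ⊕ (p ^ᵖ n)

evalAt1 : Poly → Bool
evalAt1 [] = false
evalAt1 (b ∷ p) = b xor evalAt1 p

-- prefix xors: the quotient of p by (x+1) (plus a final zero coeff when
-- (x+1) ∣ p, removed by norm).
prefixXor : Bool → Poly → Poly
prefixXor acc [] = []
prefixXor acc (b ∷ p) = (acc xor b) ∷ prefixXor (acc xor b) p

-- exact division by x+1 (meaningful when (x+1) divides p)
divX1 : Poly → Poly
divX1 p = norm (prefixXor false p)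

-- remove all factors x and x+1 (fuel-bounded; each step lowers the degree)
stripF : ℕ → Poly → Poly
stripF zero p = p
stripF (suc n) [] = []
stripF (suc n) (false ∷ p) = stripF n p
stripF (suc n) (true ∷ p) with evalAt1 (true ∷ p)
... | false = stripF n (divX1 (true ∷ p))
... | true = true ∷ p

strip : Poly → Poly
strip p = stripF (length p) (norm p)

-- one full Collatz step A_{2k} ↦ A_{2k+2} = 1 + M · A_{2k+1}
step : Poly → Poly
step p = one ⊕ (M ⊗ strip p)

iter : ℕ → Poly → Poly
iter zero p = p
iter (suc k) p = iter k (step p)

-- A_{2k+1}
oddTerm : Poly → ℕ → Poly
oddTerm A k = strip (iter k A)

-- ℓ_A = n : n = 1 + min{k : A_{2k+1} = 1}
LengthIs : Poly → ℕ → Set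
LengthIs A zero = Data.Empty.⊥
  where import Data.Empty
LengthIs A (suc m) = ((k : ℕ) → k < m → oddTerm A k ≢ one) × (oddTerm A m ≡ one)

{-# OPTIONS --safe #-}
-- Write q = 2^u and 2^r - 1 = 2n + 1, so n = 2^(r-1) - 1 is odd. In characteristic 2, raising to the
-- power q is additive, so A = Σ_{i<2n+1} M^(qi) = 1 + M^q (M+1)^q B with B = Σ_{i<n} M^(2qi); as n is
-- odd, B(0) = B(1) = 1. A polynomial 1 + M^a (M+1)^j B with j ≥ 1 takes the value 1 at 0 and at 1,
-- so it is its own odd part, and 1 + M (1 + M^a (M+1)^(j+1) B) = (M+1)(1 + M^(a+1) (M+1)^j B) with
-- M+1 = x(x+1). Hence A_{2k+1} = 1 + M^(q+k) (M+1)^(q-k) B ≠ 1 for k < q, while A_{2q} is M+1 times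
-- 1 + M^(2q) B = Σ_{i<2^(r-1)} M^(2qi) = (1 + M^(2q))^(2^(r-1) - 1) = (M+1)^(2q(2^(r-1) - 1)),
-- a product of powers of x and x+1; so A_{2q+1} = 1.
module Submission where

open import Defs
open import Algebra.Bundles using (CommutativeRing)
import Algebra.Properties.CommutativeSemigroup as CommutativeSemigroupProperties
open import Algebra.Solver.Ring.AlmostCommutativeRing using (fromCommutativeRing; -raw-almostCommutative⟶)
open import Data.Bool using (Bool; true; false; _xor_; _∧_; not; if_then_else_)
open import Data.Bool.Properties
  using ( xor-identityʳ; xor-same; xor-comm; xor-assoc; not-involutive; ∧-comm; ∧-zeroʳ; ∧-distribʳ-xor
        ; xor-∧-commutativeRing)
open import Data.Empty using (⊥-elim)
open import Data.List using ([]; _∷_; length; _++_)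
open import Data.Maybe using (nothing)
open import Data.Nat using (ℕ; zero; suc; _+_; _*_; _^_; _∸_; _<_; _≤_; s≤s)
open import Data.Nat.Properties using (+-suc; +-identityʳ; *-comm; m^n>0; m+[n∸m]≡n)
open import Data.Product using (_,_; proj₁; proj₂; ∃-syntax)
open import Level using (0ℓ)
open import Relation.Binary.Bundles using (Setoid)
open import Relation.Binary.Structures using (IsEquivalence)
open import Relation.Binary.PropositionalEquality using (_≡_; _≢_; refl; sym; trans; cong; cong₂; subst)
open import Relation.Nullary using (¬_)

module Xor = CommutativeSemigroupProperties (CommutativeRing.+-commutativeSemigroup xor-∧-commutativeRing)

coeff : Poly → ℕ → Bool
coeff []      _       = false
coeff (b ∷ p) zero    = b
coeff (b ∷ p) (suc i) = coeff p i

-- Equality as polynomials: lists differing only in trailing zeros are identified.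
infix 4 _∼_
record _∼_ (p q : Poly) : Set where
  constructor mk∼
  field at : ∀ i → coeff p i ≡ coeff q i
open _∼_

∼-refl : ∀ {p} → p ∼ p
∼-refl = mk∼ λ _ → refl

∼-reflexive : ∀ {p q} → p ≡ q → p ∼ q
∼-reflexive refl = ∼-refl

∼-sym : ∀ {p q} → p ∼ q → q ∼ p
∼-sym e = mk∼ λ i → sym (at e i)

∼-trans : ∀ {p q r} → p ∼ q → q ∼ r → p ∼ r
∼-trans e f = mk∼ λ i → trans (at e i) (at f i)

∼-isEquivalence : IsEquivalence _∼_
∼-isEquivalence = record { refl = ∼-refl ; sym = ∼-sym ; trans = ∼-trans }

∼-setoid : Setoid 0ℓ 0ℓ
∼-setoid = record { isEquivalence = ∼-isEquivalence }

open import Relation.Binary.Reasoning.Setoid ∼-setoid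

∷-cong : ∀ {a b p q} → a ≡ b → p ∼ q → a ∷ p ∼ b ∷ q
∷-cong e f = mk∼ λ { zero → e ; (suc i) → at f i }

∷-injectiveˡ : ∀ {a b p q} → a ∷ p ∼ b ∷ q → a ≡ b
∷-injectiveˡ e = at e zero

∷-injectiveʳ : ∀ {a b p q} → a ∷ p ∼ b ∷ q → p ∼ q
∷-injectiveʳ e = mk∼ λ i → at e (suc i)

[]∼false∷ : ∀ {p} → [] ∼ p → [] ∼ false ∷ p
[]∼false∷ e = mk∼ λ { zero → refl ; (suc i) → at e i }

[]∼∷⇒head≡false : ∀ {b p} → [] ∼ b ∷ p → false ≡ b
[]∼∷⇒head≡false e = at e zero

[]∼∷⇒[]∼tail : ∀ {b p} → [] ∼ b ∷ p → [] ∼ p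
[]∼∷⇒[]∼tail e = mk∼ λ i → at e (suc i)

norm∼ : ∀ p → norm p ∼ p
norm∼ []      = ∼-refl
norm∼ (b ∷ p) with norm p | norm∼ p
... | []    | e = lemma b
  where
  lemma : ∀ b → (if b then true ∷ [] else []) ∼ b ∷ p
  lemma true  = ∷-cong refl e
  lemma false = []∼false∷ e
... | _ ∷ _ | e = ∷-cong refl e

coeff-addRaw : ∀ p q i → coeff (addRaw p q) i ≡ coeff p i xor coeff q i
coeff-addRaw []      q       i       = refl
coeff-addRaw (a ∷ p) []      i       = sym (xor-identityʳ _)
coeff-addRaw (a ∷ p) (b ∷ q) zero    = refl
coeff-addRaw (a ∷ p) (b ∷ q) (suc i) = coeff-addRaw p q i

coeff-⊕ : ∀ p q i → coeff (p ⊕ q) i ≡ coeff p i xor coeff q i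
coeff-⊕ p q i = trans (at (norm∼ (addRaw p q)) i) (coeff-addRaw p q i)

⊕∼addRaw : ∀ p q → p ⊕ q ∼ addRaw p q
⊕∼addRaw p q = norm∼ (addRaw p q)

⊕-cong : ∀ {p p' q q'} → p ∼ p' → q ∼ q' → p ⊕ q ∼ p' ⊕ q'
⊕-cong {p} {p'} {q} {q'} e f =
  mk∼ λ i → trans (coeff-⊕ p q i) (trans (cong₂ _xor_ (at e i) (at f i)) (sym (coeff-⊕ p' q' i)))

⊕-congˡ : ∀ {p p'} q → p ∼ p' → p ⊕ q ∼ p' ⊕ q
⊕-congˡ q e = ⊕-cong e (∼-refl {q})

⊕-congʳ : ∀ p {q q'} → q ∼ q' → p ⊕ q ∼ p ⊕ q'
⊕-congʳ p e = ⊕-cong (∼-refl {p}) e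

⊕-comm : ∀ p q → p ⊕ q ∼ q ⊕ p
⊕-comm p q = mk∼ λ i →
  trans (coeff-⊕ p q i) (trans (xor-comm (coeff p i) _) (sym (coeff-⊕ q p i)))

⊕-assoc : ∀ p q r → (p ⊕ q) ⊕ r ∼ p ⊕ (q ⊕ r)
⊕-assoc p q r = mk∼ λ i →
  trans (coeff-⊕ (p ⊕ q) r i) (trans (cong (_xor coeff r i) (coeff-⊕ p q i))
  (trans (xor-assoc (coeff p i) _ _)
  (sym (trans (coeff-⊕ p (q ⊕ r) i) (cong (coeff p i xor_) (coeff-⊕ q r i))))))

⊕-interchange : ∀ p q r s → (p ⊕ q) ⊕ (r ⊕ s) ∼ (p ⊕ r) ⊕ (q ⊕ s)
⊕-interchange p q r s = mk∼ λ i →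
  trans (coeff-⊕ (p ⊕ q) _ i) (trans (cong₂ _xor_ (coeff-⊕ p q i) (coeff-⊕ r s i))
  (trans (Xor.interchange (coeff p i) (coeff q i) (coeff r i) (coeff s i))
  (sym (trans (coeff-⊕ (p ⊕ r) _ i) (cong₂ _xor_ (coeff-⊕ p r i) (coeff-⊕ q s i))))))

⊕-identityˡ : ∀ p → [] ⊕ p ∼ p
⊕-identityˡ p = ⊕∼addRaw [] p

⊕-identityʳ : ∀ p → p ⊕ [] ∼ p
⊕-identityʳ p = mk∼ λ i → trans (coeff-⊕ p [] i) (xor-identityʳ _)

⊕-self : ∀ p → p ⊕ p ∼ []
⊕-self p = mk∼ λ i → trans (coeff-⊕ p p i) (xor-same (coeff p i))

∷-⊕ : ∀ a b p q → (a ∷ p) ⊕ (b ∷ q) ∼ (a xor b) ∷ (p ⊕ q)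
∷-⊕ a b p q = mk∼ λ { zero → coeff-⊕ (a ∷ p) (b ∷ q) zero
                    ; (suc i) → trans (coeff-⊕ (a ∷ p) (b ∷ q) (suc i)) (sym (coeff-⊕ p q i)) }

⊕-leftComm : ∀ p q r → p ⊕ (q ⊕ r) ∼ q ⊕ (p ⊕ r)
⊕-leftComm p q r = mk∼ λ i →
  trans (coeff-⊕ p _ i) (trans (cong (coeff p i xor_) (coeff-⊕ q r i))
  (trans (Xor.x∙yz≈y∙xz (coeff p i) (coeff q i) (coeff r i))
  (sym (trans (coeff-⊕ q _ i) (cong (coeff q i xor_) (coeff-⊕ p r i))))))

false∷-⊕ : ∀ p q → false ∷ (p ⊕ q) ∼ (false ∷ p) ⊕ (false ∷ q)
false∷-⊕ p q = ∼-sym (∷-⊕ false false p q)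

scale : Bool → Poly → Poly
scale b q = if b then q else []

scale-cong : ∀ b {q q'} → q ∼ q' → scale b q ∼ scale b q'
scale-cong true  e = e
scale-cong false e = ∼-refl

scale-[] : ∀ b → scale b [] ≡ []
scale-[] true  = refl
scale-[] false = refl

scale-⊕ : ∀ b q r → scale b (q ⊕ r) ∼ scale b q ⊕ scale b r
scale-⊕ true  q r = ∼-refl
scale-⊕ false q r = ∼-sym (⊕-identityˡ [])

scale-∷ : ∀ a b q → scale a (b ∷ q) ∼ (a ∧ b) ∷ scale a q
scale-∷ true  b q = ∼-refl
scale-∷ false b q = []∼false∷ ∼-refl

scale-⊗ : ∀ a q r → scale a q ⊗ r ≡ scale a (q ⊗ r)
scale-⊗ true  q r = refl
scale-⊗ false q r = refl

⊗-step : ∀ b p q → (b ∷ p) ⊗ q ∼ scale b q ⊕ (false ∷ (p ⊗ q))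
⊗-step b p q = ⊕-cong (normed b) (norm∼ (false ∷ (p ⊗ q)))
  where
  normed : ∀ b → (if b then norm q else []) ∼ scale b q
  normed true  = norm∼ q
  normed false = ∼-refl

false∷-⊗ : ∀ p q → (false ∷ p) ⊗ q ∼ false ∷ (p ⊗ q)
false∷-⊗ p q = ∼-trans (⊗-step false p q) (⊕-identityˡ _)

⊗-congʳ : ∀ p {q q'} → q ∼ q' → p ⊗ q ∼ p ⊗ q'
⊗-congʳ []      e = ∼-refl
⊗-congʳ (b ∷ p) {q} {q'} e = begin
  (b ∷ p) ⊗ q                         ≈⟨ ⊗-step b p q ⟩
  scale b q ⊕ (false ∷ (p ⊗ q))       ≈⟨ ⊕-cong (scale-cong b e) (∷-cong refl (⊗-congʳ p e)) ⟩
  scale b q' ⊕ (false ∷ (p ⊗ q'))     ≈⟨ ⊗-step b p q' ⟨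
  (b ∷ p) ⊗ q'                        ∎

⊗-zeroʳ : ∀ p → p ⊗ [] ∼ []
⊗-zeroʳ []      = ∼-refl
⊗-zeroʳ (b ∷ p) = begin
  (b ∷ p) ⊗ []                        ≈⟨ ⊗-step b p [] ⟩
  scale b [] ⊕ (false ∷ (p ⊗ []))     ≡⟨ cong (_⊕ (false ∷ (p ⊗ []))) (scale-[] b) ⟩
  [] ⊕ (false ∷ (p ⊗ []))             ≈⟨ ⊕-identityˡ _ ⟩
  false ∷ (p ⊗ [])                    ≈⟨ []∼false∷ (∼-sym (⊗-zeroʳ p)) ⟨
  []                                  ∎

⊗-stepʳ : ∀ p b q → p ⊗ (b ∷ q) ∼ scale b p ⊕ (false ∷ (p ⊗ q))
⊗-stepʳ []      b q = begin
  []                                  ≈⟨ []∼false∷ ∼-refl ⟩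
  false ∷ []                          ≈⟨ ⊕-identityˡ _ ⟨
  [] ⊕ (false ∷ [])                   ≡⟨ cong (_⊕ (false ∷ [])) (scale-[] b) ⟨
  scale b [] ⊕ (false ∷ [])           ∎
⊗-stepʳ (a ∷ p) b q = begin
  (a ∷ p) ⊗ (b ∷ q)
    ≈⟨ ⊗-step a p (b ∷ q) ⟩
  scale a (b ∷ q) ⊕ (false ∷ (p ⊗ (b ∷ q)))
    ≈⟨ ⊕-cong (scale-∷ a b q) (∷-cong refl (⊗-stepʳ p b q)) ⟩
  ((a ∧ b) ∷ scale a q) ⊕ (false ∷ (scale b p ⊕ (false ∷ (p ⊗ q))))
    ≈⟨ ∷-⊕ (a ∧ b) false (scale a q) (scale b p ⊕ (false ∷ (p ⊗ q))) ⟩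
  ((a ∧ b) xor false) ∷ (scale a q ⊕ (scale b p ⊕ (false ∷ (p ⊗ q))))
    ≈⟨ ∷-cong (cong (_xor false) (∧-comm a b)) (⊕-leftComm (scale a q) (scale b p) _) ⟩
  ((b ∧ a) xor false) ∷ (scale b p ⊕ (scale a q ⊕ (false ∷ (p ⊗ q))))
    ≈⟨ ∷-⊕ (b ∧ a) false (scale b p) (scale a q ⊕ (false ∷ (p ⊗ q))) ⟨
  ((b ∧ a) ∷ scale b p) ⊕ (false ∷ (scale a q ⊕ (false ∷ (p ⊗ q))))
    ≈⟨ ⊕-cong (scale-∷ b a p) (∷-cong refl (⊗-step a p q)) ⟨
  scale b (a ∷ p) ⊕ (false ∷ ((a ∷ p) ⊗ q))
    ∎

⊗-comm : ∀ p q → p ⊗ q ∼ q ⊗ p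
⊗-comm []      q = ∼-sym (⊗-zeroʳ q)
⊗-comm (a ∷ p) q = begin
  (a ∷ p) ⊗ q                         ≈⟨ ⊗-step a p q ⟩
  scale a q ⊕ (false ∷ (p ⊗ q))       ≈⟨ ⊕-congʳ (scale a q) (∷-cong refl (⊗-comm p q)) ⟩
  scale a q ⊕ (false ∷ (q ⊗ p))       ≈⟨ ⊗-stepʳ q a p ⟨
  q ⊗ (a ∷ p)                         ∎

⊗-congˡ : ∀ {p p'} q → p ∼ p' → p ⊗ q ∼ p' ⊗ q
⊗-congˡ {p} {p'} q e = ∼-trans (⊗-comm p q) (∼-trans (⊗-congʳ q e) (⊗-comm q p'))

⊗-cong : ∀ {p p' q q'} → p ∼ p' → q ∼ q' → p ⊗ q ∼ p' ⊗ q'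
⊗-cong {p} {p'} {q} e f = ∼-trans (⊗-congˡ q e) (⊗-congʳ p' f)

⊗-distribˡ : ∀ p q r → p ⊗ (q ⊕ r) ∼ (p ⊗ q) ⊕ (p ⊗ r)
⊗-distribˡ []      q r = ∼-sym (⊕-identityˡ [])
⊗-distribˡ (b ∷ p) q r = begin
  (b ∷ p) ⊗ (q ⊕ r)
    ≈⟨ ⊗-step b p (q ⊕ r) ⟩
  scale b (q ⊕ r) ⊕ (false ∷ (p ⊗ (q ⊕ r)))
    ≈⟨ ⊕-cong (scale-⊕ b q r) (∼-trans (∷-cong refl (⊗-distribˡ p q r)) (false∷-⊕ (p ⊗ q) (p ⊗ r))) ⟩
  (scale b q ⊕ scale b r) ⊕ ((false ∷ (p ⊗ q)) ⊕ (false ∷ (p ⊗ r)))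
    ≈⟨ ⊕-interchange (scale b q) (scale b r) _ _ ⟩
  (scale b q ⊕ (false ∷ (p ⊗ q))) ⊕ (scale b r ⊕ (false ∷ (p ⊗ r)))
    ≈⟨ ⊕-cong (⊗-step b p q) (⊗-step b p r) ⟨
  ((b ∷ p) ⊗ q) ⊕ ((b ∷ p) ⊗ r)
    ∎

⊗-distribʳ : ∀ r p q → (p ⊕ q) ⊗ r ∼ (p ⊗ r) ⊕ (q ⊗ r)
⊗-distribʳ r p q = begin
  (p ⊕ q) ⊗ r              ≈⟨ ⊗-comm (p ⊕ q) r ⟩
  r ⊗ (p ⊕ q)              ≈⟨ ⊗-distribˡ r p q ⟩
  (r ⊗ p) ⊕ (r ⊗ q)        ≈⟨ ⊕-cong (⊗-comm r p) (⊗-comm r q) ⟩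
  (p ⊗ r) ⊕ (q ⊗ r)        ∎

⊗-assoc : ∀ p q r → (p ⊗ q) ⊗ r ∼ p ⊗ (q ⊗ r)
⊗-assoc []      q r = ∼-refl
⊗-assoc (a ∷ p) q r = begin
  ((a ∷ p) ⊗ q) ⊗ r
    ≈⟨ ⊗-congˡ r (⊗-step a p q) ⟩
  (scale a q ⊕ (false ∷ (p ⊗ q))) ⊗ r
    ≈⟨ ⊗-distribʳ r (scale a q) _ ⟩
  (scale a q ⊗ r) ⊕ ((false ∷ (p ⊗ q)) ⊗ r)
    ≈⟨ ⊕-cong (∼-reflexive (scale-⊗ a q r)) (∼-trans (false∷-⊗ (p ⊗ q) r) (∷-cong refl (⊗-assoc p q r))) ⟩
  scale a (q ⊗ r) ⊕ (false ∷ (p ⊗ (q ⊗ r)))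
    ≈⟨ ⊗-step a p (q ⊗ r) ⟨
  (a ∷ p) ⊗ (q ⊗ r)
    ∎

⊗-identityˡ : ∀ p → one ⊗ p ∼ p
⊗-identityˡ p = ∼-trans (⊗-step true [] p) (∼-trans (⊕-congʳ p (∼-sym ([]∼false∷ ∼-refl))) (⊕-identityʳ p))

⊗-identityʳ : ∀ p → p ⊗ one ∼ p
⊗-identityʳ p = ∼-trans (⊗-comm p one) (⊗-identityˡ p)

-- Characteristic 2: negation is the identity.
commutativeRing : CommutativeRing 0ℓ 0ℓ
commutativeRing = record
  { Carrier = Poly ; _≈_ = _∼_ ; _+_ = _⊕_ ; _*_ = _⊗_ ; -_ = λ p → p ; 0# = [] ; 1# = one
  ; isCommutativeRing = record
    { isRing = record
      { +-isAbelianGroup = record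
        { isGroup = record
          { isMonoid = record
            { isSemigroup = record
              { isMagma = record { isEquivalence = ∼-isEquivalence ; ∙-cong = ⊕-cong }
              ; assoc = ⊕-assoc }
            ; identity = ⊕-identityˡ , ⊕-identityʳ }
          ; inverse = ⊕-self , ⊕-self
          ; ⁻¹-cong = λ e → e }
        ; comm = ⊕-comm }
      ; *-cong = ⊗-cong
      ; *-assoc = ⊗-assoc
      ; *-identity = ⊗-identityˡ , ⊗-identityʳ
      ; distrib = ⊗-distribˡ , ⊗-distribʳ }
    ; *-comm = ⊗-comm } }

open import Algebra.Solver.Ring _ (fromCommutativeRing commutativeRing)
  (-raw-almostCommutative⟶ (fromCommutativeRing commutativeRing)) (λ _ _ → nothing)
  using (solve; _:+_; _:*_; _:=_; con)

open import Algebra.Properties.CommutativeSemiring.Exp (CommutativeRing.commutativeSemiring commutativeRing)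
  using (^-homo-*; ^-assocʳ; ^-distrib-*)
  renaming (_^_ to _^ʳ_)

^ᵖ≡^ʳ : ∀ p n → p ^ᵖ n ≡ p ^ʳ n
^ᵖ≡^ʳ p zero    = refl
^ᵖ≡^ʳ p (suc n) = cong (p ⊗_) (^ᵖ≡^ʳ p n)

^ᵖ-cong : ∀ {p p'} n → p ∼ p' → p ^ᵖ n ∼ p' ^ᵖ n
^ᵖ-cong zero    e = ∼-refl
^ᵖ-cong (suc n) e = ⊗-cong e (^ᵖ-cong n e)

^ᵖ-homo-⊗ : ∀ p m n → p ^ᵖ (m + n) ∼ (p ^ᵖ m) ⊗ (p ^ᵖ n)
^ᵖ-homo-⊗ p m n rewrite ^ᵖ≡^ʳ p (m + n) | ^ᵖ≡^ʳ p m | ^ᵖ≡^ʳ p n = ^-homo-* p m n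

^ᵖ-assocʳ : ∀ p m n → (p ^ᵖ m) ^ᵖ n ∼ p ^ᵖ (m * n)
^ᵖ-assocʳ p m n rewrite ^ᵖ≡^ʳ (p ^ᵖ m) n | ^ᵖ≡^ʳ p m | ^ᵖ≡^ʳ p (m * n) = ^-assocʳ p m n

^ᵖ-distrib-⊗ : ∀ p q n → (p ⊗ q) ^ᵖ n ∼ (p ^ᵖ n) ⊗ (q ^ᵖ n)
^ᵖ-distrib-⊗ p q n rewrite ^ᵖ≡^ʳ (p ⊗ q) n | ^ᵖ≡^ʳ p n | ^ᵖ≡^ʳ q n = ^-distrib-* p q n

^ᵖ-comm : ∀ p m n → (p ^ᵖ m) ^ᵖ n ∼ (p ^ᵖ n) ^ᵖ m
^ᵖ-comm p m n = begin
  (p ^ᵖ m) ^ᵖ n   ≈⟨ ^ᵖ-assocʳ p m n ⟩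
  p ^ᵖ (m * n)    ≡⟨ cong (p ^ᵖ_) (*-comm m n) ⟩
  p ^ᵖ (n * m)    ≈⟨ ^ᵖ-assocʳ p n m ⟨
  (p ^ᵖ n) ^ᵖ m   ∎

^ᵖ-double : ∀ p n → p ^ᵖ (2 * n) ∼ (p ^ᵖ n) ⊗ (p ^ᵖ n)
^ᵖ-double p n rewrite +-identityʳ n = ^ᵖ-homo-⊗ p n n

one-^ᵖ : ∀ n → one ^ᵖ n ∼ one
one-^ᵖ zero    = ∼-refl
one-^ᵖ (suc n) = ∼-trans (⊗-identityˡ (one ^ᵖ n)) (one-^ᵖ n)

[]-^ᵖ : ∀ n → 0 < n → [] ^ᵖ n ≡ []
[]-^ᵖ (suc n) _ = refl

⊕-square : ∀ p q → (p ⊕ q) ⊗ (p ⊕ q) ∼ (p ⊗ p) ⊕ (q ⊗ q)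
⊕-square p q = begin
  (p ⊕ q) ⊗ (p ⊕ q)                             ≈⟨ expand p q ⟩
  ((p ⊗ p) ⊕ (q ⊗ q)) ⊕ ((p ⊗ q) ⊕ (p ⊗ q))     ≈⟨ ⊕-congʳ ((p ⊗ p) ⊕ (q ⊗ q)) (⊕-self (p ⊗ q)) ⟩
  ((p ⊗ p) ⊕ (q ⊗ q)) ⊕ []                      ≈⟨ ⊕-identityʳ ((p ⊗ p) ⊕ (q ⊗ q)) ⟩
  (p ⊗ p) ⊕ (q ⊗ q)                             ∎
  where
  expand : ∀ p q → (p ⊕ q) ⊗ (p ⊕ q) ∼ ((p ⊗ p) ⊕ (q ⊗ q)) ⊕ ((p ⊗ q) ⊕ (p ⊗ q))
  expand = solve 2 (λ p q → (p :+ q) :* (p :+ q) := (p :* p :+ q :* q) :+ (p :* q :+ p :* q)) ∼-refl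

⊕-^ᵖ-2^ : ∀ u p q → (p ⊕ q) ^ᵖ (2 ^ u) ∼ (p ^ᵖ (2 ^ u)) ⊕ (q ^ᵖ (2 ^ u))
⊕-^ᵖ-2^ zero    p q = ⊗-distribʳ one p q
⊕-^ᵖ-2^ (suc u) p q = begin
  (p ⊕ q) ^ᵖ (2 * k)                            ≈⟨ ^ᵖ-double (p ⊕ q) k ⟩
  ((p ⊕ q) ^ᵖ k) ⊗ ((p ⊕ q) ^ᵖ k)               ≈⟨ ⊗-cong (⊕-^ᵖ-2^ u p q) (⊕-^ᵖ-2^ u p q) ⟩
  ((p ^ᵖ k) ⊕ (q ^ᵖ k)) ⊗ ((p ^ᵖ k) ⊕ (q ^ᵖ k)) ≈⟨ ⊕-square (p ^ᵖ k) (q ^ᵖ k) ⟩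
  ((p ^ᵖ k) ⊗ (p ^ᵖ k)) ⊕ ((q ^ᵖ k) ⊗ (q ^ᵖ k)) ≈⟨ ⊕-cong (^ᵖ-double p k) (^ᵖ-double q k) ⟨
  (p ^ᵖ (2 * k)) ⊕ (q ^ᵖ (2 * k))               ∎
  where k = 2 ^ u

geomSum-cong : ∀ {p p'} n → p ∼ p' → geomSum p n ∼ geomSum p' n
geomSum-cong zero    e = ∼-refl
geomSum-cong (suc n) e = ⊕-cong (geomSum-cong n e) (^ᵖ-cong n e)

geomSum-^ᵖ-2^ : ∀ u p n → geomSum p n ^ᵖ (2 ^ u) ∼ geomSum (p ^ᵖ (2 ^ u)) n
geomSum-^ᵖ-2^ u p zero    = ∼-reflexive ([]-^ᵖ (2 ^ u) (m^n>0 2 u))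
geomSum-^ᵖ-2^ u p (suc n) = begin
  (geomSum p n ⊕ (p ^ᵖ n)) ^ᵖ (2 ^ u)                    ≈⟨ ⊕-^ᵖ-2^ u (geomSum p n) (p ^ᵖ n) ⟩
  (geomSum p n ^ᵖ (2 ^ u)) ⊕ ((p ^ᵖ n) ^ᵖ (2 ^ u))       ≈⟨ ⊕-cong (geomSum-^ᵖ-2^ u p n) (^ᵖ-comm p n (2 ^ u)) ⟩
  geomSum (p ^ᵖ (2 ^ u)) n ⊕ ((p ^ᵖ (2 ^ u)) ^ᵖ n)       ∎

geomSum-suc : ∀ p n → geomSum p (suc n) ∼ one ⊕ (p ⊗ geomSum p n)
geomSum-suc p zero    = ∼-sym (∼-trans (⊕-congʳ one (⊗-zeroʳ p)) (⊕-identityʳ one))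
geomSum-suc p (suc n) = begin
  geomSum p (suc n) ⊕ (p ^ᵖ suc n)                       ≈⟨ ⊕-congˡ (p ^ᵖ suc n) (geomSum-suc p n) ⟩
  (one ⊕ (p ⊗ geomSum p n)) ⊕ (p ⊗ (p ^ᵖ n))             ≈⟨ regroup p (geomSum p n) (p ^ᵖ n) ⟩
  one ⊕ (p ⊗ (geomSum p n ⊕ (p ^ᵖ n)))                   ∎
  where
  regroup : ∀ p g v → (one ⊕ (p ⊗ g)) ⊕ (p ⊗ v) ∼ one ⊕ (p ⊗ (g ⊕ v))
  regroup = solve 3 (λ p g v → (con one :+ p :* g) :+ p :* v := con one :+ p :* (g :+ v)) ∼-refl

geomSum-even : ∀ p n → geomSum p (n + n) ∼ (one ⊕ p) ⊗ geomSum (p ⊗ p) n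
geomSum-even p zero    = ∼-sym (⊗-zeroʳ (one ⊕ p))
geomSum-even p (suc n) rewrite +-suc n n = begin
  (geomSum p (n + n) ⊕ (p ^ᵖ (n + n))) ⊕ (p ^ᵖ suc (n + n))
    ≈⟨ ⊕-cong (⊕-cong (geomSum-even p n) p^[n+n]) (⊗-congʳ p p^[n+n]) ⟩
  (((one ⊕ p) ⊗ geomSum (p ⊗ p) n) ⊕ ((p ⊗ p) ^ᵖ n)) ⊕ (p ⊗ ((p ⊗ p) ^ᵖ n))
    ≈⟨ regroup p (geomSum (p ⊗ p) n) ((p ⊗ p) ^ᵖ n) ⟩
  (one ⊕ p) ⊗ (geomSum (p ⊗ p) n ⊕ ((p ⊗ p) ^ᵖ n))
    ∎
  where
  p^[n+n] : p ^ᵖ (n + n) ∼ (p ⊗ p) ^ᵖ n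
  p^[n+n] = ∼-trans (^ᵖ-homo-⊗ p n n) (∼-sym (^ᵖ-distrib-⊗ p p n))
  regroup : ∀ p g v → (((one ⊕ p) ⊗ g) ⊕ v) ⊕ (p ⊗ v) ∼ (one ⊕ p) ⊗ (g ⊕ v)
  regroup = solve 3 (λ p g v → ((con one :+ p) :* g :+ v) :+ p :* v := (con one :+ p) :* (g :+ v)) ∼-refl

geomSum-odd : ∀ p n → geomSum p (suc (n + n)) ∼ one ⊕ (p ⊗ ((one ⊕ p) ⊗ geomSum (p ⊗ p) n))
geomSum-odd p n = ∼-trans (geomSum-suc p (n + n)) (⊕-congʳ one (⊗-congʳ p (geomSum-even p n)))

geomSum-2^ : ∀ s p → ∃[ e ] geomSum p (2 ^ s) ∼ (one ⊕ p) ^ᵖ e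
geomSum-2^ zero    p = 0 , ∼-refl
geomSum-2^ (suc s) p with geomSum-2^ s (p ⊗ p)
... | e , sum≈ = suc (e + e) , (begin
  geomSum p (2 * k)                  ≡⟨ cong (geomSum p) (cong (k +_) (+-identityʳ k)) ⟩
  geomSum p (k + k)                  ≈⟨ geomSum-even p k ⟩
  y ⊗ geomSum (p ⊗ p) k              ≈⟨ ⊗-congʳ y sum≈ ⟩
  y ⊗ ((one ⊕ (p ⊗ p)) ^ᵖ e)         ≈⟨ ⊗-congʳ y (^ᵖ-cong e one⊕p²) ⟩
  y ⊗ ((y ⊗ y) ^ᵖ e)                 ≈⟨ ⊗-congʳ y (^ᵖ-distrib-⊗ y y e) ⟩
  y ⊗ ((y ^ᵖ e) ⊗ (y ^ᵖ e))          ≈⟨ ⊗-congʳ y (^ᵖ-homo-⊗ y e e) ⟨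
  y ⊗ (y ^ᵖ (e + e))                 ∎)
  where
  k = 2 ^ s
  y = one ⊕ p
  one⊕p² : one ⊕ (p ⊗ p) ∼ y ⊗ y
  one⊕p² = ∼-sym (∼-trans (⊕-square one p) (⊕-congˡ (p ⊗ p) (⊗-identityˡ one)))

-- Lists without trailing zeros; canonical-injective turns ∼ back into the ≡ that strip and LengthIs see.
data Canonical : Poly → Set where
  canonical-[]  : Canonical []
  canonical-one : Canonical one
  canonical-∷   : ∀ b {c p} → Canonical (c ∷ p) → Canonical (b ∷ c ∷ p)

canonical-norm : ∀ p → Canonical (norm p)
canonical-norm []      = canonical-[]
canonical-norm (b ∷ p) with norm p | canonical-norm p
... | []    | _  = lemma b
  where
  lemma : ∀ b → Canonical (if b then true ∷ [] else [])
  lemma true  = canonical-one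
  lemma false = canonical-[]
... | _ ∷ _ | cp = canonical-∷ b cp

canonical-⊕ : ∀ p q → Canonical (p ⊕ q)
canonical-⊕ p q = canonical-norm (addRaw p q)

canonical-⊗ : ∀ p q → Canonical (p ⊗ q)
canonical-⊗ []      q = canonical-[]
canonical-⊗ (b ∷ p) q = canonical-⊕ (if b then norm q else []) (norm (false ∷ (p ⊗ q)))

canonical-∷≁[] : ∀ {c p} → Canonical (c ∷ p) → ¬ ([] ∼ c ∷ p)
canonical-∷≁[] canonical-one     e with []∼∷⇒head≡false e
... | ()
canonical-∷≁[] (canonical-∷ b cp) e = canonical-∷≁[] cp ([]∼∷⇒[]∼tail e)

canonical-injective : ∀ {p q} → Canonical p → Canonical q → p ∼ q → p ≡ q
canonical-injective canonical-[]        canonical-[]        e = refl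
canonical-injective canonical-[]        canonical-one       e = ⊥-elim (canonical-∷≁[] canonical-one e)
canonical-injective canonical-[]        (canonical-∷ b cq)  e = ⊥-elim (canonical-∷≁[] (canonical-∷ b cq) e)
canonical-injective canonical-one       canonical-[]        e = ⊥-elim (canonical-∷≁[] canonical-one (∼-sym e))
canonical-injective canonical-one       canonical-one       e = refl
canonical-injective canonical-one       (canonical-∷ b cq)  e = ⊥-elim (canonical-∷≁[] cq (∷-injectiveʳ e))
canonical-injective (canonical-∷ b cp)  canonical-[]        e = ⊥-elim (canonical-∷≁[] (canonical-∷ b cp) (∼-sym e))
canonical-injective (canonical-∷ b cp)  canonical-one       e = ⊥-elim (canonical-∷≁[] cp (∼-sym (∷-injectiveʳ e)))
canonical-injective (canonical-∷ b cp)  (canonical-∷ c cq)  e =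
  cong₂ _∷_ (∷-injectiveˡ e) (canonical-injective cp cq (∷-injectiveʳ e))

-- Ring homomorphisms F₂[x] → F₂ = (Bool, xor, ∧); the two of them are x ↦ 0 and x ↦ 1.
record IsEvaluation (h : Poly → Bool) : Set where
  field
    homo-⊕   : ∀ p q → h (p ⊕ q) ≡ h p xor h q
    homo-⊗   : ∀ p q → h (p ⊗ q) ≡ h p ∧ h q
    homo-one : h one ≡ true

evalAt0 : Poly → Bool
evalAt0 p = coeff p 0

evalAt0-isEvaluation : IsEvaluation evalAt0
evalAt0-isEvaluation = record { homo-⊕ = λ p q → coeff-⊕ p q 0 ; homo-⊗ = homo-⊗ ; homo-one = refl }
  where
  homo-⊗ : ∀ p q → evalAt0 (p ⊗ q) ≡ evalAt0 p ∧ evalAt0 q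
  homo-⊗ []      q = refl
  homo-⊗ (b ∷ p) q = trans (at (⊗-step b p q) 0) (trans (coeff-⊕ (scale b q) _ 0) (trans (xor-identityʳ _) (lemma b)))
    where
    lemma : ∀ b → evalAt0 (scale b q) ≡ b ∧ evalAt0 q
    lemma true  = refl
    lemma false = refl

evalAt1-norm : ∀ p → evalAt1 (norm p) ≡ evalAt1 p
evalAt1-norm []      = refl
evalAt1-norm (b ∷ p) with norm p | evalAt1-norm p
... | []    | e = trans (lemma b) (cong (b xor_) e)
  where
  lemma : ∀ b → evalAt1 (if b then true ∷ [] else []) ≡ b xor false
  lemma true  = refl
  lemma false = refl
... | _ ∷ _ | e = cong (b xor_) e

evalAt1-addRaw : ∀ p q → evalAt1 (addRaw p q) ≡ evalAt1 p xor evalAt1 q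
evalAt1-addRaw []      q       = refl
evalAt1-addRaw (a ∷ p) []      = sym (xor-identityʳ _)
evalAt1-addRaw (a ∷ p) (b ∷ q) =
  trans (cong ((a xor b) xor_) (evalAt1-addRaw p q)) (Xor.interchange a b (evalAt1 p) (evalAt1 q))

evalAt1-isEvaluation : IsEvaluation evalAt1
evalAt1-isEvaluation = record { homo-⊕ = homo-⊕ ; homo-⊗ = homo-⊗ ; homo-one = refl }
  where
  homo-⊕ : ∀ p q → evalAt1 (p ⊕ q) ≡ evalAt1 p xor evalAt1 q
  homo-⊕ p q = trans (evalAt1-norm (addRaw p q)) (evalAt1-addRaw p q)
  homo-⊗ : ∀ p q → evalAt1 (p ⊗ q) ≡ evalAt1 p ∧ evalAt1 q
  homo-⊗ []      q = refl
  homo-⊗ (b ∷ p) q =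
    trans (homo-⊕ (if b then norm q else []) (norm (false ∷ (p ⊗ q))))
    (trans (cong₂ _xor_ (lemma b) (trans (evalAt1-norm (false ∷ (p ⊗ q))) (homo-⊗ p q)))
    (sym (∧-distribʳ-xor (evalAt1 q) b (evalAt1 p))))
    where
    lemma : ∀ b → evalAt1 (if b then norm q else []) ≡ b ∧ evalAt1 q
    lemma true  = evalAt1-norm q
    lemma false = refl

X : Poly
X = false ∷ true ∷ []

X+1 : Poly
X+1 = true ∷ true ∷ []

M+1 : Poly
M+1 = M ⊕ one

M+1≡X⊗X+1 : M+1 ≡ X ⊗ X+1
M+1≡X⊗X+1 = refl

M≡X⊗X⊕X⊕one : M ≡ (X ⊗ X) ⊕ (X ⊕ one)
M≡X⊗X⊕X⊕one = refl

module Evaluation {h : Poly → Bool} (isEvaluation : IsEvaluation h) where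
  open IsEvaluation isEvaluation

  eval-[] : h [] ≡ false
  eval-[] = trans (homo-⊕ [] []) (xor-same (h []))

  eval-M : h M ≡ true
  eval-M = trans (cong h M≡X⊗X⊕X⊕one)
    (trans (homo-⊕ (X ⊗ X) (X ⊕ one))
    (trans (cong₂ _xor_ (homo-⊗ X X) (trans (homo-⊕ X one) (cong (h X xor_) homo-one))) (lemma (h X))))
    where
    lemma : ∀ a → (a ∧ a) xor (a xor true) ≡ true
    lemma true  = refl
    lemma false = refl

  eval-M+1 : h M+1 ≡ false
  eval-M+1 = trans (homo-⊕ M one) (cong₂ _xor_ eval-M homo-one)

  eval-M+1-multiple : ∀ n p → h ((M+1 ^ᵖ suc n) ⊗ p) ≡ false
  eval-M+1-multiple n p = trans (homo-⊗ (M+1 ^ᵖ suc n) p)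
    (cong (_∧ h p) (trans (homo-⊗ M+1 (M+1 ^ᵖ n)) (cong (_∧ h (M+1 ^ᵖ n)) eval-M+1)))

  eval-^ᵖ : ∀ {p} n → h p ≡ true → h (p ^ᵖ n) ≡ true
  eval-^ᵖ zero    hp = homo-one
  eval-^ᵖ (suc n) hp = trans (homo-⊗ _ _) (cong₂ _∧_ hp (eval-^ᵖ n hp))

  eval-geomSum-suc : ∀ {p} n → h p ≡ true → h (geomSum p (suc n)) ≡ not (h (geomSum p n))
  eval-geomSum-suc {p} n hp =
    trans (homo-⊕ (geomSum p n) (p ^ᵖ n)) (trans (cong (h (geomSum p n) xor_) (eval-^ᵖ n hp)) (xor-true _))
    where
    xor-true : ∀ a → a xor true ≡ not a
    xor-true true  = refl
    xor-true false = refl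

  eval-geomSum-odd : ∀ {p} n → h p ≡ true → h (geomSum p (suc (n + n))) ≡ true
  eval-geomSum-odd zero    hp = trans (eval-geomSum-suc 0 hp) (cong not eval-[])
  eval-geomSum-odd {p} (suc n) hp rewrite +-suc n n =
    trans (eval-geomSum-suc (suc (suc (n + n))) hp)
    (trans (cong not (eval-geomSum-suc (suc (n + n)) hp)) (trans (not-involutive _) (eval-geomSum-odd n hp)))

-- D has no root in F₂, i.e. neither x nor x+1 divides D.
NoRoot : Poly → Set
NoRoot D = ∀ {h} → IsEvaluation h → h D ≡ true

noRoot-M : NoRoot M
noRoot-M isEvaluation = Evaluation.eval-M isEvaluation

noRoot-⊗ : ∀ {p q} → NoRoot p → NoRoot q → NoRoot (p ⊗ q)
noRoot-⊗ {p} {q} np nq isEvaluation =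
  trans (IsEvaluation.homo-⊗ isEvaluation p q) (cong₂ _∧_ (np isEvaluation) (nq isEvaluation))

noRoot-^ᵖ : ∀ {p} n → NoRoot p → NoRoot (p ^ᵖ n)
noRoot-^ᵖ n np isEvaluation = Evaluation.eval-^ᵖ isEvaluation n (np isEvaluation)

noRoot-geomSum-odd : ∀ {p} n → NoRoot p → NoRoot (geomSum p (suc (n + n)))
noRoot-geomSum-odd n np isEvaluation = Evaluation.eval-geomSum-odd isEvaluation n (np isEvaluation)

¬noRoot-[] : ¬ NoRoot []
¬noRoot-[] noRoot with noRoot evalAt0-isEvaluation
... | ()

X⊗ : ∀ p → X ⊗ p ∼ false ∷ p
X⊗ p = ∼-trans (false∷-⊗ (true ∷ []) p) (∷-cong refl (⊗-identityˡ p))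

-- Stated for the raw sum, which is what stripF inspects.
X+1⊗ : ∀ p → X+1 ⊗ p ∼ addRaw p (false ∷ p)
X+1⊗ p = ∼-trans (⊗-step true (true ∷ []) p)
  (∼-trans (⊕-congʳ p (∷-cong refl (⊗-identityˡ p))) (⊕∼addRaw p (false ∷ p)))

M+1-^ᵖ : ∀ n → M+1 ^ᵖ n ∼ (X ^ᵖ n) ⊗ (X+1 ^ᵖ n)
M+1-^ᵖ n rewrite M+1≡X⊗X+1 = ^ᵖ-distrib-⊗ X X+1 n

length-shiftedSum : ∀ c p → length (addRaw p (c ∷ p)) ≡ suc (length p)
length-shiftedSum c []      = refl
length-shiftedSum c (b ∷ p) = cong suc (length-shiftedSum b p)

canonical-shiftedSum : ∀ c {b p} → Canonical (b ∷ p) → Canonical (addRaw (b ∷ p) (c ∷ b ∷ p))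
canonical-shiftedSum c canonical-one      = canonical-∷ _ canonical-one
canonical-shiftedSum c (canonical-∷ b cp) = canonical-∷ _ (canonical-shiftedSum b cp)

xor-cancelˡ : ∀ a b → a xor (b xor a) ≡ b
xor-cancelˡ true  true  = refl
xor-cancelˡ true  false = refl
xor-cancelˡ false b     = xor-identityʳ b

prefixXor-shiftedSum : ∀ acc p → prefixXor acc (addRaw p (acc ∷ p)) ≡ p ++ (false ∷ [])
prefixXor-shiftedSum acc []      = cong (_∷ []) (xor-same acc)
prefixXor-shiftedSum acc (b ∷ p) rewrite xor-cancelˡ acc b = cong (b ∷_) (prefixXor-shiftedSum b p)

++false∼ : ∀ p → p ++ (false ∷ []) ∼ p
++false∼ []      = ∼-sym ([]∼false∷ ∼-refl)
++false∼ (b ∷ p) = ∷-cong refl (++false∼ p)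

divX1-shiftedSum : ∀ {p} → Canonical p → divX1 (addRaw p (false ∷ p)) ≡ p
divX1-shiftedSum {p} cp = trans (cong norm (prefixXor-shiftedSum false p))
  (canonical-injective (canonical-norm (p ++ (false ∷ []))) cp (∼-trans (norm∼ (p ++ (false ∷ []))) (++false∼ p)))

evalAt1-shiftedSum : ∀ p → evalAt1 (addRaw p (false ∷ p)) ≡ false
evalAt1-shiftedSum p = trans (evalAt1-addRaw p (false ∷ p)) (xor-same (evalAt1 p))

stripF-noRoot : ∀ {D} → NoRoot D → stripF (length D) D ≡ D
stripF-noRoot {[]}        noRoot = ⊥-elim (¬noRoot-[] noRoot)
stripF-noRoot {false ∷ D} noRoot with noRoot evalAt0-isEvaluation
... | ()
stripF-noRoot {true ∷ D}  noRoot with evalAt1 (true ∷ D) | noRoot evalAt1-isEvaluation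
... | true  | _  = refl
... | false | ()

stripF-divX1 : ∀ n p → evalAt1 (true ∷ p) ≡ false → stripF (suc n) (true ∷ p) ≡ stripF n (divX1 (true ∷ p))
stripF-divX1 n p e with evalAt1 (true ∷ p)
stripF-divX1 n p refl | false = refl

stripF-X· : ∀ {P R D} → Canonical P → Canonical R → NoRoot D →
            stripF (length R) R ≡ D → P ∼ false ∷ R → stripF (length P) P ≡ D
stripF-X· {R = []}    cP cR noRoot refl e = ⊥-elim (¬noRoot-[] noRoot)
stripF-X· {R = _ ∷ _} cP cR noRoot sR e with canonical-injective cP (canonical-∷ false cR) e
... | refl = sR

stripF-X+1· : ∀ {P R D} → Canonical P → Canonical R → evalAt0 R ≡ true →
              stripF (length R) R ≡ D → P ∼ addRaw R (false ∷ R) → stripF (length P) P ≡ D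
stripF-X+1· {R = []}        _  _  () _  _
stripF-X+1· {R = false ∷ _} _  _  () _  _
stripF-X+1· {R = true ∷ R}  cP cR _  sR e with canonical-injective cP (canonical-shiftedSum false cR) e
... | refl = trans (stripF-divX1 _ (addRaw R (true ∷ R)) (evalAt1-shiftedSum (true ∷ R)))
  (trans (cong₂ stripF (length-shiftedSum true R) (divX1-shiftedSum cR)) sR)

stripF-X^a[X+1]^b : ∀ a b {P D} → Canonical P → Canonical D → NoRoot D →
                    P ∼ (X ^ᵖ a) ⊗ ((X+1 ^ᵖ b) ⊗ D) → stripF (length P) P ≡ D
stripF-X^a[X+1]^b zero zero {P} {D} cP cD noRoot e =
  trans (cong (λ p → stripF (length p) p) (canonical-injective cP cD P∼D)) (stripF-noRoot noRoot)
  where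
  P∼D : P ∼ D
  P∼D = ∼-trans e (∼-trans (⊗-identityˡ (one ⊗ D)) (⊗-identityˡ D))
stripF-X^a[X+1]^b (suc a) b {P} {D} cP cD noRoot e =
  stripF-X· cP (canonical-⊗ (X ^ᵖ a) R) noRoot (stripF-X^a[X+1]^b a b (canonical-⊗ (X ^ᵖ a) R) cD noRoot ∼-refl)
    (∼-trans e (∼-trans (⊗-assoc X (X ^ᵖ a) R) (X⊗ ((X ^ᵖ a) ⊗ R))))
  where R = (X+1 ^ᵖ b) ⊗ D
stripF-X^a[X+1]^b zero (suc b) {P} {D} cP cD noRoot e =
  stripF-X+1· cP (canonical-⊗ (X+1 ^ᵖ b) D) R[0]≡1
    (stripF-X^a[X+1]^b zero b (canonical-⊗ (X+1 ^ᵖ b) D) cD noRoot (∼-sym (⊗-identityˡ R)))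
    (∼-trans e (∼-trans (⊗-identityˡ ((X+1 ⊗ (X+1 ^ᵖ b)) ⊗ D)) (∼-trans (⊗-assoc X+1 (X+1 ^ᵖ b) D) (X+1⊗ R))))
  where
  R = (X+1 ^ᵖ b) ⊗ D
  R[0]≡1 : evalAt0 R ≡ true
  R[0]≡1 = trans (IsEvaluation.homo-⊗ evalAt0-isEvaluation (X+1 ^ᵖ b) D)
    (cong₂ _∧_ (Evaluation.eval-^ᵖ evalAt0-isEvaluation b refl) (noRoot evalAt0-isEvaluation))

strip-canonical : ∀ {P} → Canonical P → strip P ≡ stripF (length P) P
strip-canonical {P} cP = cong (stripF (length P)) (canonical-injective (canonical-norm P) cP (norm∼ P))

strip-M+1^ : ∀ n {P D} → Canonical P → Canonical D → NoRoot D → P ∼ (M+1 ^ᵖ n) ⊗ D → strip P ≡ D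
strip-M+1^ n {P} {D} cP cD noRoot e = trans (strip-canonical cP) (stripF-X^a[X+1]^b n n cP cD noRoot
  (∼-trans e (∼-trans (⊗-congˡ D (M+1-^ᵖ n)) (⊗-assoc (X ^ᵖ n) (X+1 ^ᵖ n) D))))

-- The odd terms of the orbit of A are shape B (q + k) (q - k) with B = Σ_{i<n} M^(2qi).
shape : Poly → ℕ → ℕ → Poly
shape B a j = one ⊕ ((M ^ᵖ a) ⊗ ((M+1 ^ᵖ j) ⊗ B))

canonical-shape : ∀ B a j → Canonical (shape B a j)
canonical-shape B a j = canonical-⊕ one ((M ^ᵖ a) ⊗ ((M+1 ^ᵖ j) ⊗ B))

noRoot-shape : ∀ B a j → NoRoot (shape B a (suc j))
noRoot-shape B a j {h} isEvaluation =
  trans (homo-⊕ one ((M ^ᵖ a) ⊗ ((M+1 ^ᵖ suc j) ⊗ B)))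
  (cong₂ _xor_ homo-one (trans (homo-⊗ (M ^ᵖ a) _) (trans (cong (h (M ^ᵖ a) ∧_) (eval-M+1-multiple j B)) (∧-zeroʳ _))))
  where
  open IsEvaluation isEvaluation
  open Evaluation isEvaluation

step-shape : ∀ B a j → one ⊕ (M ⊗ shape B a (suc j)) ∼ M+1 ⊗ shape B (suc a) j
step-shape B a j = solve 4
  (λ m x z b → con one :+ m :* (con one :+ x :* (((m :+ con one) :* z) :* b))
            := (m :+ con one) :* (con one :+ (m :* x) :* (z :* b)))
  ∼-refl M (M ^ᵖ a) (M+1 ^ᵖ j) B

strip-shape : ∀ B a j → strip (shape B a (suc j)) ≡ shape B a (suc j)
strip-shape B a j =
  strip-M+1^ 0 (canonical-shape B a (suc j)) (canonical-shape B a (suc j)) (noRoot-shape B a j)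
    (∼-sym (⊗-identityˡ (shape B a (suc j))))

strip-step-shape : ∀ {B P} a j → strip P ≡ shape B a (suc (suc j)) → strip (step P) ≡ shape B (suc a) (suc j)
strip-step-shape {B} a j e rewrite e =
  strip-M+1^ 1 (canonical-⊕ one (M ⊗ shape B a (suc (suc j))))
    (canonical-shape B (suc a) (suc j)) (noRoot-shape B (suc a) j)
    (∼-trans (step-shape B a (suc j)) (⊗-congˡ (shape B (suc a) (suc j)) (∼-sym (⊗-identityʳ M+1))))

strip-step-shape-final : ∀ {B P} a e →
  strip P ≡ shape B a 1 → shape B (suc a) 0 ∼ M+1 ^ᵖ e → strip (step P) ≡ one
strip-step-shape-final {B} a e eq last rewrite eq =
  strip-M+1^ (suc e) (canonical-⊕ one (M ⊗ shape B a 1)) canonical-one IsEvaluation.homo-one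
    (∼-trans (step-shape B a 0) (∼-trans (⊗-congʳ M+1 last) (∼-sym (⊗-identityʳ (M+1 ^ᵖ suc e)))))

⊕-cancelˡ : ∀ p q → q ⊕ (q ⊕ p) ∼ p
⊕-cancelˡ p q = ∼-trans (∼-sym (⊕-assoc q q p)) (∼-trans (⊕-congˡ p (⊕-self q)) (⊕-identityˡ p))

shape≢one : ∀ {B} a j → NoRoot B → shape B a (suc j) ≢ one
shape≢one {B} a j noRoot eq = ¬noRoot-[] (subst NoRoot (sym D≡[]) (noRoot-⊗ (noRoot-^ᵖ a noRoot-M) noRoot))
  where
  D = (M ^ᵖ a) ⊗ B
  E = (M ^ᵖ a) ⊗ ((M+1 ^ᵖ suc j) ⊗ B)
  E∼[] : E ∼ []
  E∼[] = begin
    E                 ≈⟨ ⊕-cancelˡ E one ⟨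
    one ⊕ shape B a (suc j) ≡⟨ cong (one ⊕_) eq ⟩
    one ⊕ one         ≈⟨ ⊕-self one ⟩
    []                ∎
  leftComm : ∀ x y z → x ⊗ (y ⊗ z) ∼ y ⊗ (x ⊗ z)
  leftComm = solve 3 (λ x y z → x :* (y :* z) := y :* (x :* z)) ∼-refl
  D≡[] : [] ≡ D
  D≡[] = strip-M+1^ (suc j) canonical-[] (canonical-⊗ (M ^ᵖ a) B) (noRoot-⊗ (noRoot-^ᵖ a noRoot-M) noRoot)
    (∼-trans (∼-sym E∼[]) (leftComm (M ^ᵖ a) (M+1 ^ᵖ suc j) B))

strip-iter-shape : ∀ {B} k {a j P} → strip P ≡ shape B a (suc (k + j)) → strip (iter k P) ≡ shape B (a + k) (suc j)
strip-iter-shape zero    {a}     e rewrite +-identityʳ a = e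
strip-iter-shape {B} (suc k) {a} {j} {P} e rewrite +-suc a k =
  strip-iter-shape {B} k {suc a} {j} {step P} (strip-step-shape {B} {P} a (k + j) e)

iter-sucʳ : ∀ k p → iter (suc k) p ≡ step (iter k p)
iter-sucʳ zero    p = refl
iter-sucʳ (suc k) p = iter-sucʳ k (step p)

lengthIs-shape : ∀ {B e} q → 0 < q → NoRoot B → shape B (2 * q) 0 ∼ M+1 ^ᵖ e → LengthIs (shape B q q) (suc q)
lengthIs-shape {B} {e} (suc j) _ noRoot last = notOne , isOne
  where
  q = suc j
  A = shape B q q
  oddTerm≡shape : ∀ k i → k + i ≡ j → oddTerm A k ≡ shape B (q + k) (suc i)
  oddTerm≡shape k i k+i≡j =
    strip-iter-shape {B} k {q} {i} {A} (trans (strip-shape B q j) (cong (λ n → shape B q (suc n)) (sym k+i≡j)))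
  notOne : ∀ k → k < q → oddTerm A k ≢ one
  notOne k (s≤s k≤j) rewrite oddTerm≡shape k (j ∸ k) (m+[n∸m]≡n k≤j) = shape≢one (q + k) (j ∸ k) noRoot
  2q≡1+q+j : 2 * q ≡ suc (q + j)
  2q≡1+q+j = trans (cong (q +_) (+-identityʳ q)) (+-suc q j)
  isOne : oddTerm A q ≡ one
  isOne = trans (cong strip (iter-sucʳ j A))
    (strip-step-shape-final {B} {iter j A} (q + j) e (oddTerm≡shape j 0 (+-identityʳ j))
      (subst (λ n → shape B n 0 ∼ M+1 ^ᵖ e) 2q≡1+q+j last))

canonical-^ᵖ : ∀ p n → 0 < n → Canonical (p ^ᵖ n)
canonical-^ᵖ p (suc n) _ = canonical-⊗ p (p ^ᵖ n)

one⊕M^[2^u]≈M+1^[2^u] : ∀ u → one ⊕ (M ^ᵖ (2 ^ u)) ∼ M+1 ^ᵖ (2 ^ u)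
one⊕M^[2^u]≈M+1^[2^u] u = begin
  one ⊕ (M ^ᵖ k)          ≈⟨ ⊕-comm one (M ^ᵖ k) ⟩
  (M ^ᵖ k) ⊕ one          ≈⟨ ⊕-congʳ (M ^ᵖ k) (one-^ᵖ k) ⟨
  (M ^ᵖ k) ⊕ (one ^ᵖ k)   ≈⟨ ⊕-^ᵖ-2^ u M one ⟨
  M+1 ^ᵖ k                ∎
  where k = 2 ^ u

geomSum-odd-^ᵖ-2^ : ∀ u n →
  geomSum M (suc (n + n)) ^ᵖ (2 ^ u) ∼ shape (geomSum (M ^ᵖ (2 * 2 ^ u)) n) (2 ^ u) (2 ^ u)
geomSum-odd-^ᵖ-2^ u n = begin
  geomSum M (suc (n + n)) ^ᵖ q
    ≈⟨ geomSum-^ᵖ-2^ u M (suc (n + n)) ⟩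
  geomSum Z (suc (n + n))
    ≈⟨ geomSum-odd Z n ⟩
  one ⊕ (Z ⊗ ((one ⊕ Z) ⊗ geomSum (Z ⊗ Z) n))
    ≈⟨ ⊕-congʳ one (⊗-congʳ Z (⊗-cong (one⊕M^[2^u]≈M+1^[2^u] u) (geomSum-cong n Z⊗Z≈M^2q))) ⟩
  one ⊕ (Z ⊗ ((M+1 ^ᵖ q) ⊗ geomSum (M ^ᵖ (2 * q)) n))
    ∎
  where
  q = 2 ^ u
  Z = M ^ᵖ q
  Z⊗Z≈M^2q : Z ⊗ Z ∼ M ^ᵖ (2 * q)
  Z⊗Z≈M^2q = ∼-sym (^ᵖ-double M q)

shape-2q-0≈M+1^ : ∀ u s → ∃[ e ] shape (geomSum (M ^ᵖ (2 * 2 ^ u)) (2 ^ s ∸ 1)) (2 * 2 ^ u) 0 ∼ M+1 ^ᵖ e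
shape-2q-0≈M+1^ u s with geomSum-2^ s (M ^ᵖ (2 * 2 ^ u))
... | e , sum≈ = 2 * 2 ^ u * e , (begin
  one ⊕ (W ⊗ (one ⊗ B))         ≈⟨ ⊕-congʳ one (⊗-congʳ W (⊗-identityˡ B)) ⟩
  one ⊕ (W ⊗ B)                 ≈⟨ geomSum-suc W (2 ^ s ∸ 1) ⟨
  geomSum W (suc (2 ^ s ∸ 1))   ≡⟨ cong (geomSum W) (m+[n∸m]≡n (m^n>0 2 s)) ⟩
  geomSum W (2 ^ s)             ≈⟨ sum≈ ⟩
  (one ⊕ W) ^ᵖ e                ≈⟨ ^ᵖ-cong e (one⊕M^[2^u]≈M+1^[2^u] (suc u)) ⟩
  (M+1 ^ᵖ (2 * 2 ^ u)) ^ᵖ e     ≈⟨ ^ᵖ-assocʳ M+1 (2 * 2 ^ u) e ⟩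
  M+1 ^ᵖ (2 * 2 ^ u * e)        ∎)
  where
  W = M ^ᵖ (2 * 2 ^ u)
  B = geomSum W (2 ^ s ∸ 1)

2^[1+s]∸1 : ∀ s → 2 ^ suc s ∸ 1 ≡ suc ((2 ^ s ∸ 1) + (2 ^ s ∸ 1))
2^[1+s]∸1 s = double∸1 (2 ^ s) (m^n>0 2 s)
  where
  double∸1 : ∀ k → 0 < k → 2 * k ∸ 1 ≡ suc ((k ∸ 1) + (k ∸ 1))
  double∸1 (suc c) _ = trans (+-suc c (c + 0)) (cong (λ x → suc (c + x)) (+-identityʳ c))

lemma3p3 : (r u : ℕ) → 2 ≤ r → 1 ≤ u →
    LengthIs (geomSum M ((2 ^ r) ∸ 1) ^ᵖ (2 ^ u)) (1 + 2 ^ u)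
lemma3p3 1 _ (s≤s ()) _
lemma3p3 (suc (suc s)) u _ _ =
  subst (λ A → LengthIs A (suc q)) (sym A≡shape)
    (lengthIs-shape {e = proj₁ last} q (m^n>0 2 u) noRoot-B (proj₂ last))
  where
  q n : ℕ
  q = 2 ^ u
  n = 2 ^ suc s ∸ 1
  B : Poly
  B = geomSum (M ^ᵖ (2 * q)) n
  noRoot-B : NoRoot B
  noRoot-B = subst (λ m → NoRoot (geomSum (M ^ᵖ (2 * q)) m)) (sym (2^[1+s]∸1 s))
    (noRoot-geomSum-odd (2 ^ s ∸ 1) (noRoot-^ᵖ (2 * q) noRoot-M))
  A≡shape : geomSum M (2 ^ suc (suc s) ∸ 1) ^ᵖ q ≡ shape B q q
  A≡shape = canonical-injective (canonical-^ᵖ _ q (m^n>0 2 u)) (canonical-shape B q q)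
    (subst (λ m → geomSum M m ^ᵖ q ∼ shape B q q) (sym (2^[1+s]∸1 (suc s))) (geomSum-odd-^ᵖ-2^ u n))
  last : ∃[ e ] shape B (2 * q) 0 ∼ M+1 ^ᵖ e
  last = shape-2q-0≈M+1^ u (suc s)
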